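{- A rack $R$ is a $G$-rack if and only if its corresponding quandle $\bar{R}$ is a $G$-rack.
   Context: A rack is a set $R$ with a binary operation $\triangleright$ such that $a\triangleright(b\triangleright c)=(a\triangleright b)\triangleright(a\triangleright c)$ for all $a,b,c\in R$, and for all $a,b\in R$ there is a unique $x\in R$ with $a\triangleright x=b$; a quandle is a rack with $x\triangleright x=x$ for all $x$. A subrack is a subset $Q$ with $(Q,\triangleright)$ a rack; $\ll S\gg$ is the intersection of all subracks containing $S$. The atoms of the lattice of subracks of $R$ (ordered by inclusion) are exactly the subracks $\ll\{x\}\gg$, $x\in R$, and these atoms partition $R$. The corresponding quandle $(\bar{R},*)$ is the set of atoms with the operation $A*B=C$, where for $a\in A$, $b\in B$, $C$ is the atom containing $a\triangleright b$ (this is well defined and $\bar R$ is a quandle). For $a\in R$, $f_a(b)=a\triangleright b$; $\mathrm{Inn}(R)$ is the group generated by the $f_a$, and the orbits of $R$ are the orbits of $\mathrm{Inn}(R)$ acting on $R$. A rack is a $G$-rack if it is the only subrack of itself having nonempty intersection with every one of its orbits. -}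

module Defs where

open import Level using (Level; _⊔_) renaming (suc to lsuc)
open import Data.Product using (Σ; ∃; _×_; _,_)
open import Function.Bundles using (_⇔_)
open import Relation.Binary.PropositionalEquality using (_≡_)

-- Racks use _≡_; the corresponding quandle R̄ is represented
-- by the carrier of R with equality "same atom" (no quotient types in Agda).
record RawStr (c e : Level) : Set (lsuc (c ⊔ e)) where
  field
    Carrier : Set c
    _≈_     : Carrier → Carrier → Set e
    _▷_     : Carrier → Carrier → Carrier

module _ {c e : Level} (X : RawStr c e) where
  open RawStr X

  record IsSubrack {p : Level} (Q : Carrier → Set p) : Set (c ⊔ e ⊔ p) where
    field
      respects : ∀ {x y} → x ≈ y → Q x → Q y
      closed   : ∀ {a b} → Q a → Q b → Q (a ▷ b)
      distrib  : ∀ {a b d} → Q a → Q b → Q d →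
                 (a ▷ (b ▷ d)) ≈ ((a ▷ b) ▷ (a ▷ d))
      solve    : ∀ {a b} → Q a → Q b →
                 Σ Carrier (λ x → Q x × (a ▷ x) ≈ b ×
                   (∀ y → Q y → (a ▷ y) ≈ b → y ≈ x))

  -- InOrbit x y : y lies in the orbit of x under Inn, the group generated by
  -- the maps f_a = (a ▷_) (words in the f_a and their inverses).
  data InOrbit (x : Carrier) : Carrier → Set (c ⊔ e) where
    base  : ∀ {y} → x ≈ y → InOrbit x y
    app   : ∀ a {y} → InOrbit x y → InOrbit x (a ▷ y)
    unapp : ∀ a {y z} → InOrbit x y → (a ▷ z) ≈ y → InOrbit x z

  -- G-rack: the only subrack meeting every orbit is the whole structure.
  -- (The whole structure trivially meets every orbit.)  Subsets range over
  -- predicates of level p.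
  IsGRack : (p : Level) → Set (c ⊔ e ⊔ lsuc p)
  IsGRack p = (Q : Carrier → Set p) → IsSubrack Q →
              (∀ x → ∃ λ y → Q y × InOrbit x y) →
              ∀ z → Q z

record Rack (ℓ : Level) : Set (lsuc ℓ) where
  field
    Carrier : Set ℓ
    _▷_     : Carrier → Carrier → Carrier
    distrib : ∀ a b d → (a ▷ (b ▷ d)) ≡ ((a ▷ b) ▷ (a ▷ d))
    solve   : ∀ a b → Σ Carrier (λ x → (a ▷ x) ≡ b × (∀ y → (a ▷ y) ≡ b → y ≡ x))

module _ {ℓ : Level} (R : Rack ℓ) where
  open Rack R

  toRaw : RawStr ℓ ℓ
  toRaw = record { Carrier = Carrier ; _≈_ = _≡_ ; _▷_ = _▷_ }

  ⟪_⟫ : Carrier → Carrier → Set (lsuc ℓ)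
  ⟪ x ⟫ z = (Q : Carrier → Set ℓ) → IsSubrack toRaw Q → Q x → Q z

  -- Corresponding quandle R̄: elements are the atoms ≪{x}≫ (represented by x),
  -- two representatives being equal iff their atoms are the same subset;
  -- ≪{a}≫ * ≪{b}≫ = atom containing a ▷ b.
  Bar : RawStr ℓ (lsuc ℓ)
  Bar = record
    { Carrier = Carrier
    ; _≈_ = λ x y → ∀ z → ⟪ x ⟫ z ⇔ ⟪ y ⟫ z
    ; _▷_ = _▷_
    }

-- R̄ is represented by the carrier of R with the equality x ∼ y meaning
-- "x and y generate the same atom ≪{x}≫ = ≪{y}≫".  The whole proof rests on
-- one observation: every automorphism of R maps atoms to atoms, so it
-- preserves and reflects ∼.  Applied to the left translations f_a = (a ▷_)
-- this gives the cancellation law  a ▷ x ∼ a ▷ y → x ∼ y.  From it: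
--   * subracks of R and subracks of R̄ are the same subsets (a subrack of R
--     is automatically a union of atoms, and cancellation turns solutions of
--     a ▷ x ∼ b into solutions of a ▷ x ≡ b and back);
--   * orbits of R̄ are orbits of R up to ∼ (translations preserve ∼), so a
--     union of atoms meets every orbit of R̄ iff it meets every orbit of R.
-- Both directions of the theorem then follow by feeding a subset that is a
-- subrack meeting every orbit on one side to the G-rack property of the
-- other side.
module Submission where

open import Defs
open import Level using (Level; _⊔_) renaming (suc to lsuc)
open import Function.Bundles using (_⇔_; mk⇔; Equivalence)
open import Function.Construct.Identity using (⇔-id)
open import Function.Construct.Symmetry using (⇔-sym)
open import Function.Construct.Composition using (_⇔-∘_)
open import Data.Product using (Σ; ∃; _×_; _,_; proj₁; proj₂)
open import Relation.Binary.PropositionalEquality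
  using (_≡_; refl; sym; trans; cong; cong₂; subst; subst₂; module ≡-Reasoning)

open Equivalence using (from)

MeetsAllOrbits : ∀ {c e p} (X : RawStr c e) → (RawStr.Carrier X → Set p) → Set (c ⊔ e ⊔ p)
MeetsAllOrbits X Q = ∀ x → ∃ λ y → Q y × InOrbit X x y

module Atoms {ℓ : Level} (R : Rack ℓ) where
  open Rack R

  Atom : Carrier → Carrier → Set (lsuc ℓ)
  Atom = ⟪_⟫ R

  infix 4 _∼_
  _∼_ : Carrier → Carrier → Set (lsuc ℓ)
  x ∼ y = ∀ z → Atom x z ⇔ Atom y z

  ∼-refl : ∀ {x} → x ∼ x
  ∼-refl _ = ⇔-id _

  ∼-sym : ∀ {x y} → x ∼ y → y ∼ x
  ∼-sym e z = ⇔-sym (e z)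

  ∼-trans : ∀ {x y w} → x ∼ y → y ∼ w → x ∼ w
  ∼-trans e f z = f z ⇔-∘ e z

  ≡⇒∼ : ∀ {x y} → x ≡ y → x ∼ y
  ≡⇒∼ refl = ∼-refl

  atom-self : ∀ x → Atom x x
  atom-self _ _ _ qx = qx

  atom-least : ∀ {Q : Carrier → Set ℓ} → IsSubrack (toRaw R) Q → ∀ {x z} → Q x → Atom x z → Q z
  atom-least S qx h = h _ S qx

  subrack-saturated : ∀ {Q : Carrier → Set ℓ} → IsSubrack (toRaw R) Q →
                      ∀ {x y} → x ∼ y → Q x → Q y
  subrack-saturated S {y = y} e qx = atom-least S qx (from (e y) (atom-self y))

  record Automorphism : Set ℓ where
    field
      φ ψ : Carrier → Carrier
      φ∘ψ : ∀ x → φ (ψ x) ≡ x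
      ψ∘φ : ∀ x → ψ (φ x) ≡ x
      hom : ∀ a b → φ (a ▷ b) ≡ φ a ▷ φ b

  inverse : Automorphism → Automorphism
  inverse A = record { φ = ψ ; ψ = φ ; φ∘ψ = ψ∘φ ; ψ∘φ = φ∘ψ ; hom = ψ-hom }
    where
      open Automorphism A
      ψ-hom : ∀ a b → ψ (a ▷ b) ≡ ψ a ▷ ψ b
      ψ-hom a b = begin
        ψ (a ▷ b)                 ≡⟨ cong ψ (cong₂ _▷_ (sym (φ∘ψ a)) (sym (φ∘ψ b))) ⟩
        ψ (φ (ψ a) ▷ φ (ψ b))     ≡⟨ cong ψ (sym (hom (ψ a) (ψ b))) ⟩
        ψ (φ (ψ a ▷ ψ b))         ≡⟨ ψ∘φ _ ⟩
        ψ a ▷ ψ b                 ∎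
        where open ≡-Reasoning

  module _ (A : Automorphism) where
    open Automorphism A

    preimage-subrack : ∀ {p} {Q : Carrier → Set p} → IsSubrack (toRaw R) Q →
                       IsSubrack (toRaw R) (λ z → Q (φ z))
    preimage-subrack {Q = Q} S = record
      { respects = λ { refl q → q }
      ; closed   = λ {a} {b} qa qb → subst Q (sym (hom a b)) (S.closed qa qb)
      ; distrib  = λ {a} {b} {d} _ _ _ → distrib a b d
      ; solve    = preimage-solve
      }
      where
        module S = IsSubrack S
        preimage-solve : ∀ {a b} → Q (φ a) → Q (φ b) →
          Σ Carrier (λ x → Q (φ x) × (a ▷ x) ≡ b × (∀ y → Q (φ y) → (a ▷ y) ≡ b → y ≡ x))
        preimage-solve {a} {b} qa qb with S.solve qa qb
        ... | x , qx , ax≡b , unique = ψ x , subst Q (sym (φ∘ψ x)) qx , solves , unique′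
          where
            open ≡-Reasoning
            solves : a ▷ ψ x ≡ b
            solves = begin
              a ▷ ψ x           ≡⟨ sym (ψ∘φ _) ⟩
              ψ (φ (a ▷ ψ x))   ≡⟨ cong ψ (hom a (ψ x)) ⟩
              ψ (φ a ▷ φ (ψ x)) ≡⟨ cong (λ w → ψ (φ a ▷ w)) (φ∘ψ x) ⟩
              ψ (φ a ▷ x)       ≡⟨ cong ψ ax≡b ⟩
              ψ (φ b)           ≡⟨ ψ∘φ b ⟩
              b                 ∎
            unique′ : ∀ y → Q (φ y) → (a ▷ y) ≡ b → y ≡ ψ x
            unique′ y qy ay≡b =
              trans (sym (ψ∘φ y)) (cong ψ (unique (φ y) qy φa▷φy≡φb))
              where
                φa▷φy≡φb : φ a ▷ φ y ≡ φ b
                φa▷φy≡φb = trans (sym (hom a y)) (cong φ ay≡b)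

    atom-image : ∀ {x z} → Atom x z → Atom (φ x) (φ z)
    atom-image h Q S qφx = h (λ z → Q (φ z)) (preimage-subrack S) qφx

  atom-transport : (A : Automorphism) → let open Automorphism A in
                   ∀ x z → Atom (φ x) (φ z) ⇔ Atom x z
  atom-transport A x z = mk⇔ back (atom-image A)
    where
      open Automorphism A
      back : Atom (φ x) (φ z) → Atom x z
      back h = subst₂ Atom (ψ∘φ x) (ψ∘φ z) (atom-image (inverse A) h)

  reflects-∼ : (A : Automorphism) → let open Automorphism A in
               ∀ {x y} → φ x ∼ φ y → x ∼ y
  reflects-∼ A {x} {y} e z =
    atom-transport A y z ⇔-∘ (e (Automorphism.φ A z) ⇔-∘ ⇔-sym (atom-transport A x z))

  preserves-∼ : (A : Automorphism) → let open Automorphism A in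
                ∀ {x y} → x ∼ y → φ x ∼ φ y
  preserves-∼ A {x} {y} e =
    reflects-∼ (inverse A) (∼-trans (≡⇒∼ (ψ∘φ x)) (∼-trans e (≡⇒∼ (sym (ψ∘φ y)))))
    where open Automorphism A

  infixr 6 _▷⁻¹_
  _▷⁻¹_ : Carrier → Carrier → Carrier
  a ▷⁻¹ b = proj₁ (solve a b)

  ▷-▷⁻¹ : ∀ a b → a ▷ (a ▷⁻¹ b) ≡ b
  ▷-▷⁻¹ a b = proj₁ (proj₂ (solve a b))

  ▷⁻¹-unique : ∀ a b y → a ▷ y ≡ b → y ≡ a ▷⁻¹ b
  ▷⁻¹-unique a b = proj₂ (proj₂ (solve a b))

  translation : Carrier → Automorphism
  translation a = record
    { φ = a ▷_ ; ψ = a ▷⁻¹_ ; φ∘ψ = ▷-▷⁻¹ a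
    ; ψ∘φ = λ y → sym (▷⁻¹-unique a (a ▷ y) y refl) ; hom = distrib a }

  ▷-cancel-∼ : ∀ a {x y} → a ▷ x ∼ a ▷ y → x ∼ y
  ▷-cancel-∼ a = reflects-∼ (translation a)

  subrack⇒bar-subrack : ∀ {Q : Carrier → Set ℓ} →
                        IsSubrack (toRaw R) Q → IsSubrack (Bar R) Q
  subrack⇒bar-subrack {Q = Q} S = record
    { respects = subrack-saturated S
    ; closed   = S.closed
    ; distrib  = λ {a} {b} {d} _ _ _ → ≡⇒∼ (distrib a b d)
    ; solve    = bar-solve
    }
    where
      module S = IsSubrack S
      bar-solve : ∀ {a b} → Q a → Q b →
        Σ Carrier (λ x → Q x × (a ▷ x) ∼ b × (∀ y → Q y → (a ▷ y) ∼ b → y ∼ x))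
      bar-solve {a} qa qb with S.solve qa qb
      ... | x , qx , ax≡b , _ =
        x , qx , ≡⇒∼ ax≡b , λ y _ ay∼b → ▷-cancel-∼ a (∼-trans ay∼b (≡⇒∼ (sym ax≡b)))

  bar-subrack⇒subrack : ∀ {p} {Q : Carrier → Set p} →
                        IsSubrack (Bar R) Q → IsSubrack (toRaw R) Q
  bar-subrack⇒subrack {Q = Q} S = record
    { respects = λ { refl q → q }
    ; closed   = S.closed
    ; distrib  = λ {a} {b} {d} _ _ _ → distrib a b d
    ; solve    = rack-solve
    }
    where
      module S = IsSubrack S
      rack-solve : ∀ {a b} → Q a → Q b →
        Σ Carrier (λ x → Q x × (a ▷ x) ≡ b × (∀ y → Q y → (a ▷ y) ≡ b → y ≡ x))
      rack-solve {a} {b} qa qb with S.solve qa qb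
      ... | x , qx , ax∼b , _ =
        a ▷⁻¹ b ,
        S.respects (▷-cancel-∼ a (∼-trans ax∼b (≡⇒∼ (sym (▷-▷⁻¹ a b))))) qx ,
        ▷-▷⁻¹ a b ,
        λ y _ → ▷⁻¹-unique a b y

  orbit⇒bar-orbit : ∀ {x y} → InOrbit (toRaw R) x y → InOrbit (Bar R) x y
  orbit⇒bar-orbit (base refl)   = base ∼-refl
  orbit⇒bar-orbit (app a o)     = app a (orbit⇒bar-orbit o)
  orbit⇒bar-orbit (unapp a o e)   = unapp a (orbit⇒bar-orbit o) (≡⇒∼ e)

  bar-orbit⇒orbit : ∀ {x y} → InOrbit (Bar R) x y →
                    ∃ λ y′ → InOrbit (toRaw R) x y′ × y′ ∼ y
  bar-orbit⇒orbit {x} (base x∼y) = x , base refl , x∼y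
  bar-orbit⇒orbit (app a o) with bar-orbit⇒orbit o
  ... | y′ , o′ , y′∼y = a ▷ y′ , app a o′ , preserves-∼ (translation a) y′∼y
  bar-orbit⇒orbit (unapp a o az∼y) with bar-orbit⇒orbit o
  ... | y′ , o′ , y′∼y =
    a ▷⁻¹ y′ , unapp a o′ (▷-▷⁻¹ a y′) ,
    ▷-cancel-∼ a (∼-trans (≡⇒∼ (▷-▷⁻¹ a y′)) (∼-trans y′∼y (∼-sym az∼y)))

  meets⇒bar-meets : ∀ {p} {Q : Carrier → Set p} →
                    MeetsAllOrbits (toRaw R) Q → MeetsAllOrbits (Bar R) Q
  meets⇒bar-meets M x with M x
  ... | y , qy , o = y , qy , orbit⇒bar-orbit o

  bar-meets⇒meets : ∀ {p} {Q : Carrier → Set p} →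
                    (∀ {x y} → x ∼ y → Q x → Q y) →
                    MeetsAllOrbits (Bar R) Q → MeetsAllOrbits (toRaw R) Q
  bar-meets⇒meets saturated M x with M x
  ... | y , qy , o with bar-orbit⇒orbit o
  ...   | y′ , o′ , y′∼y = y′ , saturated (∼-sym y′∼y) qy , o′

lemma4p3 : ∀ {ℓ : Level} (R : Rack ℓ) →
    IsGRack (toRaw R) ℓ ⇔ IsGRack (Bar R) ℓ
lemma4p3 {ℓ} R = mk⇔ rack⇒bar bar⇒rack
  where
    open Atoms R
    rack⇒bar : IsGRack (toRaw R) ℓ → IsGRack (Bar R) ℓ
    rack⇒bar G Q S M =
      G Q (bar-subrack⇒subrack S) (bar-meets⇒meets (IsSubrack.respects S) M)
    bar⇒rack : IsGRack (Bar R) ℓ → IsGRack (toRaw R) ℓ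
    bar⇒rack G Q S M = G Q (subrack⇒bar-subrack S) (meets⇒bar-meets M)
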